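{- Let $\Gamma_n=\log\log(d_n+1)-(n-1)$ for $n\ge 1$. Then $\Gamma_n>0$ for all $n$, and the sequence $(\Gamma_n)$ is strictly decreasing for $n\geq 2$, i.e. $\Gamma_{n+1}<\Gamma_n$ for all $n\ge 2$.
   Context: All logarithms are to base two. A delta-matroid $(E,\mathcal F)$ consists of a finite set $E$ and a non-empty collection $\mathcal F$ of subsets of $E$ satisfying: for all $X,Y\in\mathcal F$ and every $e\in X\bigtriangleup Y$ there exists $f\in X\bigtriangleup Y$ (possibly $f=e$) with $X\bigtriangleup\{e,f\}\in\mathcal F$. Let $d_n$ denote the number of delta-matroids with ground set $[n]=\{1,\dots,n\}$. -}

module Defs where

open import Data.Bool using (Bool; true; false)
import Data.Bool as Bool
import Data.Vec as Vec
open import Data.Nat using (ℕ; zero; suc)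
open import Data.Fin using (Fin)
open import Data.Fin.Subset using (Subset; _∈_; _∪_; _─_; ⁅_⁆)
open import Data.Fin.Subset.Properties using (_∈?_; anySubset?)
open import Data.Fin.Properties using (all?; any?)
open import Data.Product using (Σ; ∃; _×_; _,_)
open import Data.List using (List; []; _∷_; length; filter; cartesianProduct)
open import Relation.Binary.PropositionalEquality using (_≡_)
open import Relation.Nullary using (Dec; yes; no; ¬_)
open import Relation.Nullary.Decidable using (_×-dec_; _→-dec_; ¬?)

_△_ : ∀ {n} → Subset n → Subset n → Subset n
X △ Y = (X ─ Y) ∪ (Y ─ X)

-- A collection of subsets of [n] (i.e. a subset of the power set of [n]),
-- encoded canonically as a binary trie: for n = suc m, the first component
-- records the members not containing the first element, the second those
-- containing it.  This encoding is a bijection with collections of subsets.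
Family : ℕ → Set
Family zero    = Bool
Family (suc n) = Family n × Family n

mem : ∀ {n} → Family n → Subset n → Bool
mem {zero}  b       _            = b
mem {suc n} (F , G) (false Vec.∷ X) = mem F X
mem {suc n} (F , G) (true Vec.∷ X)  = mem G X

_∈ℱ_ : ∀ {n} → Subset n → Family n → Set
X ∈ℱ F = mem F X ≡ true

allFamilies : (n : ℕ) → List (Family n)
allFamilies zero    = true ∷ false ∷ []
allFamilies (suc n) = cartesianProduct (allFamilies n) (allFamilies n)

IsDeltaMatroid : ∀ {n} → Family n → Set
IsDeltaMatroid {n} F =
  (∃ λ (X : Subset n) → X ∈ℱ F) ×
  (∀ (X Y : Subset n) → X ∈ℱ F → Y ∈ℱ F →
     ∀ (e : Fin n) → e ∈ (X △ Y) →
       ∃ λ (f : Fin n) → f ∈ (X △ Y) × (X △ (⁅ e ⁆ ∪ ⁅ f ⁆)) ∈ℱ F)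

private
  allSubset? : ∀ {n} {P : Subset n → Set} → (∀ X → Dec (P X)) → Dec (∀ X → P X)
  allSubset? {P = P} P? with anySubset? (λ X → ¬? (P? X))
  ... | yes (X , ¬p) = no (λ h → ¬p (h X))
  ... | no ¬∃ = yes (λ X → helper X)
    where
    helper : ∀ X → P X
    helper X with P? X
    ... | yes p = p
    ... | no ¬p = Data.Empty.⊥-elim (¬∃ (X , ¬p))
      where import Data.Empty

  _∈ℱ?_ : ∀ {n} (X : Subset n) (F : Family n) → Dec (X ∈ℱ F)
  X ∈ℱ? F = mem F X Bool.≟ true

isDeltaMatroid? : ∀ {n} (F : Family n) → Dec (IsDeltaMatroid F)
isDeltaMatroid? F =
  anySubset? (λ X → X ∈ℱ? F) ×-dec
  allSubset? (λ X → allSubset? (λ Y →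
    (X ∈ℱ? F) →-dec ((Y ∈ℱ? F) →-dec
      all? (λ e → (e ∈? (X △ Y)) →-dec
        any? (λ f → (f ∈? (X △ Y)) ×-dec ((X △ (⁅ e ⁆ ∪ ⁅ f ⁆)) ∈ℱ? F))))))

d : ℕ → ℕ
d n = length (filter isDeltaMatroid? (allFamilies n))

-- Both parts are Γ_n > 0 and Γ_{n+1} < Γ_n with the logarithms exponentiated away.
--
-- Lower bound: a family containing every odd set is a delta-matroid, since toggling one
-- element of an even set, or two elements of an odd set, yields an odd set; for n ≥ 1
-- there are 2^(2^(n-1)) such families, one per collection of even sets.
--
-- Growth: a family on [n+1] is the pair of its deletion and contraction at the first
-- element, and the exchange axiom passes to both.  Hence the d (n+1) + 1 families on
-- [n+1] that are delta-matroids or empty embed into pairs of such families on [n], of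
-- which there are (d n + 1)^2; for n ≥ 2 the pair coming from {∅, {0,1,2}} is missed.
module Submission where

open import Defs
open import Data.Nat using (ℕ; suc; _+_; _∸_; _^_; _≤_; _<_)
open import Data.Product using (_×_)

open import Data.Nat using (zero; _*_; s≤s; z<s)
open import Data.Nat.Properties
  using (*-zeroʳ; *-identityʳ; +-suc; +-identityʳ; *-distribʳ-+; ^-distribˡ-+-*; m<m+n; ≤∧≢⇒<; module ≤-Reasoning)
open import Data.Bool using (Bool; true; false; not; _∨_; _xor_; T)
open import Data.Bool.Properties
  using (_≟_; T?; not-involutive; not-distribˡ-xor; not-distribʳ-xor; xor-annihilates-not)
open import Data.Fin using (Fin; zero; suc)
open import Data.Fin.Properties using (suc-injective)
open import Data.Fin.Subset using (Subset; _∈_; _∉_; _∪_; ⁅_⁆; ⊥)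
open import Data.Fin.Subset.Properties using (∪-idem; ∪-identityˡ; ∪-identityʳ; nonempty?; Empty-unique)
open import Data.Vec using ([]; _∷_; here; there)
open import Data.Product using (∃; _,_; proj₂)
open import Data.Sum using (_⊎_; inj₁; inj₂)
import Data.Sum as Sum
open import Data.Empty using (⊥-elim)
open import Data.List using (List; []; _∷_; [_]; length; filter; map; _++_; cartesianProduct)
open import Data.List.Properties using (filter-++; length-++)
import Data.List.Membership.Propositional as List
open import Data.List.Membership.Propositional.Properties using (∈-filter⁺; ∈-filter⁻; ∈-cartesianProduct⁺)
import Data.List.Relation.Unary.Any as Any
open import Data.List.Relation.Binary.Pointwise using (Pointwise-≡⇒≡)
open import Data.List.Relation.Binary.Sublist.Heterogeneous.Properties
  using (length-mono-≤; ⊆-filter-Sublist; toPointwise)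
import Data.List.Relation.Binary.Sublist.Propositional as Sublist
open import Function using (_∘_)
open import Relation.Binary.PropositionalEquality
  using (_≡_; _≢_; refl; sym; trans; cong; cong₂; subst; module ≡-Reasoning)
open import Relation.Nullary using (yes; no; ¬_; contradiction)
open import Relation.Unary using (Pred; Decidable; _⊆_; _⟨×⟩_)
open import Relation.Unary.Properties using (_∪?_; _×?_)

private variable n m : ℕ

count : ∀ {a p} {A : Set a} {P : Pred A p} → Decidable P → List A → ℕ
count P? xs = length (filter P? xs)

module _ {a p} {A : Set a} {P : Pred A p} (P? : Decidable P) where

  count-++ : ∀ xs ys → count P? (xs ++ ys) ≡ count P? xs + count P? ys
  count-++ xs ys = trans (cong length (filter-++ P? xs ys)) (length-++ (filter P? xs))

module _ {a p q} {A : Set a} {P : Pred A p} {Q : Pred A q}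
         (P? : Decidable P) (Q? : Decidable Q) where

  filter-⊆-filter : P ⊆ Q → ∀ xs → filter P? xs Sublist.⊆ filter Q? xs
  filter-⊆-filter P⊆Q xs = ⊆-filter-Sublist P? Q? (λ { refl → P⊆Q }) (Sublist.⊆-refl {x = xs})

  count-mono : P ⊆ Q → ∀ xs → count P? xs ≤ count Q? xs
  count-mono P⊆Q xs = length-mono-≤ (filter-⊆-filter P⊆Q xs)

  -- A sublist of the same length is the whole list, and x separates the two.
  count-mono-< : P ⊆ Q → ∀ {x xs} → x List.∈ xs → Q x → ¬ P x → count P? xs < count Q? xs
  count-mono-< P⊆Q {x} {xs} x∈xs Qx ¬Px = ≤∧≢⇒< (count-mono P⊆Q xs) same-length⇒P
    where
    same-length⇒P : count P? xs ≢ count Q? xs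
    same-length⇒P eq = ¬Px (proj₂ (∈-filter⁻ P? {xs = xs} x∈filterP))
      where
      x∈filterP : x List.∈ filter P? xs
      x∈filterP = subst (x List.∈_) (sym (Pointwise-≡⇒≡ (toPointwise eq (filter-⊆-filter P⊆Q xs))))
                        (∈-filter⁺ Q? x∈xs Qx)

  count-∪ : (∀ {x} → P x → ¬ Q x) → ∀ xs → count (P? ∪? Q?) xs ≡ count P? xs + count Q? xs
  count-∪ P⊥Q [] = refl
  count-∪ P⊥Q (x ∷ xs) with P? x | Q? x
  ... | yes Px | yes Qx = contradiction Qx (P⊥Q Px)
  ... | yes _  | no _   = cong suc (count-∪ P⊥Q xs)
  ... | no _   | yes _  = trans (cong suc (count-∪ P⊥Q xs)) (sym (+-suc _ _))
  ... | no _   | no _   = count-∪ P⊥Q xs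

module _ {a b p q} {A : Set a} {B : Set b} {P : Pred A p} {Q : Pred B q}
         (P? : Decidable P) (Q? : Decidable Q) where

  count-map-pair : ∀ x ys → count (P? ×? Q?) (map (x ,_) ys) ≡ count P? [ x ] * count Q? ys
  count-map-pair x [] = sym (*-zeroʳ (count P? [ x ]))
  count-map-pair x (y ∷ ys) with P? x | Q? y | count-map-pair x ys
  ... | yes _ | yes _ | ih = cong suc ih
  ... | yes _ | no _  | ih = ih
  ... | no _  | _     | ih = ih

  count-cartesianProduct : ∀ xs ys →
    count (P? ×? Q?) (cartesianProduct xs ys) ≡ count P? xs * count Q? ys
  count-cartesianProduct [] ys = refl
  count-cartesianProduct (x ∷ xs) ys = begin
    count (P? ×? Q?) (map (x ,_) ys ++ cartesianProduct xs ys)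
      ≡⟨ count-++ (P? ×? Q?) (map (x ,_) ys) _ ⟩
    count (P? ×? Q?) (map (x ,_) ys) + count (P? ×? Q?) (cartesianProduct xs ys)
      ≡⟨ cong₂ _+_ (count-map-pair x ys) (count-cartesianProduct xs ys) ⟩
    count P? [ x ] * count Q? ys + count P? xs * count Q? ys
      ≡⟨ *-distribʳ-+ (count Q? ys) (count P? [ x ]) (count P? xs) ⟨
    (count P? [ x ] + count P? xs) * count Q? ys
      ≡⟨ cong (_* count Q? ys) (count-++ P? [ x ] xs) ⟨
    count P? (x ∷ xs) * count Q? ys ∎
    where open ≡-Reasoning

parity : Subset n → Bool
parity []      = false
parity (b ∷ X) = b xor parity X

parity-⊥ : parity (⊥ {n}) ≡ false
parity-⊥ {zero}  = refl
parity-⊥ {suc n} = parity-⊥ {n}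

parity-⁅x⁆ : (x : Fin n) → parity ⁅ x ⁆ ≡ true
parity-⁅x⁆ {suc n} zero = cong not (parity-⊥ {n})
parity-⁅x⁆ (suc x)      = parity-⁅x⁆ x

parity-⁅x⁆∪⁅y⁆ : {x y : Fin n} → x ≢ y → parity (⁅ x ⁆ ∪ ⁅ y ⁆) ≡ false
parity-⁅x⁆∪⁅y⁆ {x = zero}  {zero}  x≢y = contradiction refl x≢y
parity-⁅x⁆∪⁅y⁆ {x = zero}  {suc y} _   = cong not (trans (cong parity (∪-identityˡ ⁅ y ⁆)) (parity-⁅x⁆ y))
parity-⁅x⁆∪⁅y⁆ {x = suc x} {zero}  _   = cong not (trans (cong parity (∪-identityʳ ⁅ x ⁆)) (parity-⁅x⁆ x))
parity-⁅x⁆∪⁅y⁆ {x = suc x} {suc y} x≢y = parity-⁅x⁆∪⁅y⁆ (x≢y ∘ cong suc)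

parity-△ : (X Y : Subset n) → parity (X △ Y) ≡ parity X xor parity Y
parity-△ []          []          = refl
parity-△ (false ∷ X) (false ∷ Y) = parity-△ X Y
parity-△ (false ∷ X) (true ∷ Y)  = trans (cong not (parity-△ X Y)) (not-distribʳ-xor (parity X) (parity Y))
parity-△ (true ∷ X)  (false ∷ Y) = trans (cong not (parity-△ X Y)) (not-distribˡ-xor (parity X) (parity Y))
parity-△ (true ∷ X)  (true ∷ Y)  = trans (parity-△ X Y) (sym (xor-annihilates-not (parity X) (parity Y)))

△-cancelˡ : (X Y : Subset n) → X △ (X △ Y) ≡ Y
△-cancelˡ []          []          = refl
△-cancelˡ (false ∷ X) (false ∷ Y) = cong (false ∷_) (△-cancelˡ X Y)
△-cancelˡ (false ∷ X) (true ∷ Y)  = cong (true ∷_) (△-cancelˡ X Y)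
△-cancelˡ (true ∷ X)  (false ∷ Y) = cong (false ∷_) (△-cancelˡ X Y)
△-cancelˡ (true ∷ X)  (true ∷ Y)  = cong (true ∷_) (△-cancelˡ X Y)

x∉p△p : {x : Fin n} (p : Subset n) → x ∉ p △ p
x∉p△p (false ∷ p) (there x∈) = x∉p△p p x∈
x∉p△p (true ∷ p)  (there x∈) = x∉p△p p x∈

x∈p⇒p≡⁅x⁆⊎∃y≢x : {x : Fin n} {p : Subset n} → x ∈ p → p ≡ ⁅ x ⁆ ⊎ ∃ λ y → y ∈ p × y ≢ x
x∈p⇒p≡⁅x⁆⊎∃y≢x {p = true ∷ p} here with nonempty? p
... | yes (y , y∈p) = inj₂ (suc y , there y∈p , λ ())
... | no ¬nonempty  = inj₁ (cong (true ∷_) (Empty-unique ¬nonempty))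
x∈p⇒p≡⁅x⁆⊎∃y≢x {p = true ∷ p} (there _) = inj₂ (zero , here , λ ())
x∈p⇒p≡⁅x⁆⊎∃y≢x {p = false ∷ p} (there x∈p) =
  Sum.map (cong (false ∷_)) (λ (y , y∈p , y≢x) → suc y , there y∈p , y≢x ∘ suc-injective)
          (x∈p⇒p≡⁅x⁆⊎∃y≢x x∈p)

allFamilies-complete : (F : Family n) → F List.∈ allFamilies n
allFamilies-complete {zero}  true    = Any.here refl
allFamilies-complete {zero}  false   = Any.there (Any.here refl)
allFamilies-complete {suc n} (F , G) = ∈-cartesianProduct⁺ (allFamilies-complete F) (allFamilies-complete G)

IsEmpty : Family n → Set
IsEmpty {zero}  b = b ≡ false
IsEmpty {suc n}   = IsEmpty ⟨×⟩ IsEmpty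

isEmpty? : Decidable (IsEmpty {n})
isEmpty? {zero}  b = b ≟ false
isEmpty? {suc n}   = isEmpty? ×? isEmpty?

count-isEmpty : ∀ n → count isEmpty? (allFamilies n) ≡ 1
count-isEmpty zero    = refl
count-isEmpty (suc n) =
  trans (count-cartesianProduct isEmpty? isEmpty? (allFamilies n) (allFamilies n))
        (cong₂ _*_ (count-isEmpty n) (count-isEmpty n))

isEmpty⇒∉ℱ : {F : Family n} → IsEmpty F → ∀ X → ¬ X ∈ℱ F
isEmpty⇒∉ℱ {zero}  refl      []          ()
isEmpty⇒∉ℱ {suc n} (F∅ , _)  (false ∷ X) = isEmpty⇒∉ℱ F∅ X
isEmpty⇒∉ℱ {suc n} (_ , G∅)  (true ∷ X)  = isEmpty⇒∉ℱ G∅ X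

isEmpty⊎∈ℱ : (F : Family n) → IsEmpty F ⊎ ∃ λ X → X ∈ℱ F
isEmpty⊎∈ℱ {zero}  true  = inj₂ ([] , refl)
isEmpty⊎∈ℱ {zero}  false = inj₁ refl
isEmpty⊎∈ℱ {suc n} (F , G) with isEmpty⊎∈ℱ F | isEmpty⊎∈ℱ G
... | inj₂ (X , X∈F) | _              = inj₂ (false ∷ X , X∈F)
... | inj₁ _         | inj₂ (X , X∈G) = inj₂ (true ∷ X , X∈G)
... | inj₁ F∅        | inj₁ G∅        = inj₁ (F∅ , G∅)

∅ℱ : Family n
∅ℱ {zero}  = false
∅ℱ {suc n} = ∅ℱ , ∅ℱ

isEmpty-∅ℱ : IsEmpty (∅ℱ {n})
isEmpty-∅ℱ {zero}  = refl
isEmpty-∅ℱ {suc n} = isEmpty-∅ℱ {n} , isEmpty-∅ℱ {n}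

∉∅ℱ : (X : Subset n) → ¬ X ∈ℱ ∅ℱ
∉∅ℱ {n} = isEmpty⇒∉ℱ (isEmpty-∅ℱ {n})

⁅_⁆ℱ : Subset n → Family n
⁅ []        ⁆ℱ = true
⁅ false ∷ S ⁆ℱ = ⁅ S ⁆ℱ , ∅ℱ
⁅ true ∷ S  ⁆ℱ = ∅ℱ , ⁅ S ⁆ℱ

X∈⁅X⁆ℱ : (X : Subset n) → X ∈ℱ ⁅ X ⁆ℱ
X∈⁅X⁆ℱ []          = refl
X∈⁅X⁆ℱ (false ∷ X) = X∈⁅X⁆ℱ X
X∈⁅X⁆ℱ (true ∷ X)  = X∈⁅X⁆ℱ X

X∈⁅Y⁆ℱ⇒X≡Y : (X Y : Subset n) → X ∈ℱ ⁅ Y ⁆ℱ → X ≡ Y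
X∈⁅Y⁆ℱ⇒X≡Y []          []          _  = refl
X∈⁅Y⁆ℱ⇒X≡Y (false ∷ X) (false ∷ Y) X∈ = cong (false ∷_) (X∈⁅Y⁆ℱ⇒X≡Y X Y X∈)
X∈⁅Y⁆ℱ⇒X≡Y (true ∷ X)  (true ∷ Y)  X∈ = cong (true ∷_) (X∈⁅Y⁆ℱ⇒X≡Y X Y X∈)
X∈⁅Y⁆ℱ⇒X≡Y (false ∷ X) (true ∷ Y)  X∈ = ⊥-elim (∉∅ℱ X X∈)
X∈⁅Y⁆ℱ⇒X≡Y (true ∷ X)  (false ∷ Y) X∈ = ⊥-elim (∉∅ℱ X X∈)

-- IsDeltaMatroid F unfolds to (∃ λ X → X ∈ℱ F) × Exchange F.
Exchange : Family n → Set
Exchange {n} F = ∀ (X Y : Subset n) → X ∈ℱ F → Y ∈ℱ F →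
  ∀ (e : Fin n) → e ∈ (X △ Y) →
    ∃ λ (f : Fin n) → f ∈ (X △ Y) × (X △ (⁅ e ⁆ ∪ ⁅ f ⁆)) ∈ℱ F

exchange-deletion : {F G : Family n} → Exchange (F , G) → Exchange F
exchange-deletion ex X Y X∈ Y∈ e e∈ with ex (false ∷ X) (false ∷ Y) X∈ Y∈ (suc e) (there e∈)
... | suc f , there f∈ , Z∈ = f , f∈ , Z∈

exchange-contraction : {F G : Family n} → Exchange (F , G) → Exchange G
exchange-contraction ex X Y X∈ Y∈ e e∈ with ex (true ∷ X) (true ∷ Y) X∈ Y∈ (suc e) (there e∈)
... | suc f , there f∈ , Z∈ = f , f∈ , Z∈

⁅⁆ℱ-isDeltaMatroid : (S : Subset n) → IsDeltaMatroid ⁅ S ⁆ℱ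
⁅⁆ℱ-isDeltaMatroid S = (S , X∈⁅X⁆ℱ S) , exchange
  where
  exchange : Exchange ⁅ S ⁆ℱ
  exchange X Y X∈ Y∈ e e∈
    rewrite X∈⁅Y⁆ℱ⇒X≡Y X S X∈ | X∈⁅Y⁆ℱ⇒X≡Y Y S Y∈ = ⊥-elim (x∉p△p S e∈)

IsDeltaMatroidOrEmpty : Family n → Set
IsDeltaMatroidOrEmpty F = IsDeltaMatroid F ⊎ IsEmpty F

isDeltaMatroidOrEmpty? : Decidable (IsDeltaMatroidOrEmpty {n})
isDeltaMatroidOrEmpty? = isDeltaMatroid? ∪? isEmpty?

count-isDeltaMatroidOrEmpty : ∀ n → count isDeltaMatroidOrEmpty? (allFamilies n) ≡ d n + 1
count-isDeltaMatroidOrEmpty n =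
  trans (count-∪ isDeltaMatroid? isEmpty? (λ ((X , X∈) , _) F∅ → isEmpty⇒∉ℱ F∅ X X∈) (allFamilies n))
        (cong (d n +_) (count-isEmpty n))

exchange⇒isDeltaMatroidOrEmpty : {F : Family n} → Exchange F → IsDeltaMatroidOrEmpty F
exchange⇒isDeltaMatroidOrEmpty {F = F} ex with isEmpty⊎∈ℱ F
... | inj₁ F∅     = inj₂ F∅
... | inj₂ member = inj₁ (member , ex)

isDeltaMatroidOrEmpty-minors :
  IsDeltaMatroidOrEmpty {suc n} ⊆ (IsDeltaMatroidOrEmpty ⟨×⟩ IsDeltaMatroidOrEmpty)
isDeltaMatroidOrEmpty-minors (inj₁ (_ , ex)) =
  exchange⇒isDeltaMatroidOrEmpty (exchange-deletion ex) ,
  exchange⇒isDeltaMatroidOrEmpty (exchange-contraction ex)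
isDeltaMatroidOrEmpty-minors (inj₂ (F∅ , G∅)) = inj₂ F∅ , inj₂ G∅

module _ {m : ℕ} where

  private
    ∅ S : Subset (2 + m)
    ∅ = ⊥
    S = true ∷ true ∷ ⊥

  -- The family {∅, {0,1,2}}.
  farPair : Family (3 + m)
  farPair = ⁅ ∅ ⁆ℱ , ⁅ S ⁆ℱ

  -- One exchange step from ∅ only reaches sets of size at most 2.
  ¬exchange-farPair : ¬ Exchange farPair
  ¬exchange-farPair ex with ex (false ∷ ∅) (true ∷ S) (X∈⁅X⁆ℱ ∅) (X∈⁅X⁆ℱ S) zero here
  ... | zero        , _ , Z∈ with () ← X∈⁅Y⁆ℱ⇒X≡Y (⊥ △ (⊥ ∪ ⊥)) S Z∈
  ... | suc zero    , _ , Z∈ with () ← X∈⁅Y⁆ℱ⇒X≡Y (⊥ △ (⊥ ∪ ⁅ zero ⁆)) S Z∈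
  ... | suc (suc f) , _ , Z∈ with () ← X∈⁅Y⁆ℱ⇒X≡Y (⊥ △ (⊥ ∪ ⁅ suc f ⁆)) S Z∈

  ¬isDeltaMatroidOrEmpty-farPair : ¬ IsDeltaMatroidOrEmpty farPair
  ¬isDeltaMatroidOrEmpty-farPair (inj₁ (_ , ex))  = ¬exchange-farPair ex
  ¬isDeltaMatroidOrEmpty-farPair (inj₂ (F∅ , _)) = isEmpty⇒∉ℱ F∅ ∅ (X∈⁅X⁆ℱ ∅)

  farPair-minors : (IsDeltaMatroidOrEmpty ⟨×⟩ IsDeltaMatroidOrEmpty) farPair
  farPair-minors = inj₁ (⁅⁆ℱ-isDeltaMatroid ∅) , inj₁ (⁅⁆ℱ-isDeltaMatroid S)

-- Defined along the trie so that it is a product predicate at every successor;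
-- the only subset of the empty ground set is even.
ContainsAllOfParity : Bool → Family n → Set
ContainsAllOfParity {zero}  p b = T (p ∨ b)
ContainsAllOfParity {suc n} p   = ContainsAllOfParity p ⟨×⟩ ContainsAllOfParity (not p)

containsAllOfParity? : (p : Bool) → Decidable (ContainsAllOfParity {n} p)
containsAllOfParity? {zero}  p b = T? (p ∨ b)
containsAllOfParity? {suc n} p   = containsAllOfParity? p ×? containsAllOfParity? (not p)

containsAllOfParity⇒∈ℱ : ∀ {p} {F : Family n} → ContainsAllOfParity p F →
                          ∀ X → parity X ≡ p → X ∈ℱ F
containsAllOfParity⇒∈ℱ {zero}  {false} {true} _ [] _ = refl
containsAllOfParity⇒∈ℱ {suc n} (F⊇ , _) (false ∷ X) pX = containsAllOfParity⇒∈ℱ F⊇ X pX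
containsAllOfParity⇒∈ℱ {suc n} (_ , G⊇) (true ∷ X)  pX =
  containsAllOfParity⇒∈ℱ G⊇ X (trans (sym (not-involutive (parity X))) (cong not pX))

count-containsAllOfParity : ∀ m p → count (containsAllOfParity? p) (allFamilies (suc m)) ≡ 2 ^ 2 ^ m
count-containsAllOfParity zero    false = refl
count-containsAllOfParity zero    true  = refl
count-containsAllOfParity (suc m) p     = begin
  count (containsAllOfParity? p ×? containsAllOfParity? (not p)) (cartesianProduct L L)
    ≡⟨ count-cartesianProduct (containsAllOfParity? p) (containsAllOfParity? (not p)) L L ⟩
  count (containsAllOfParity? p) L * count (containsAllOfParity? (not p)) L
    ≡⟨ cong₂ _*_ (count-containsAllOfParity m p) (count-containsAllOfParity m (not p)) ⟩
  2 ^ 2 ^ m * 2 ^ 2 ^ m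
    ≡⟨ ^-distribˡ-+-* 2 (2 ^ m) (2 ^ m) ⟨
  2 ^ (2 ^ m + 2 ^ m)
    ≡⟨ cong (λ k → 2 ^ (2 ^ m + k)) (+-identityʳ (2 ^ m)) ⟨
  2 ^ 2 ^ suc m ∎
  where
  open ≡-Reasoning
  L = allFamilies (suc m)

containsAllOdd⇒isDeltaMatroid : {F : Family (suc m)} → ContainsAllOfParity true F → IsDeltaMatroid F
containsAllOdd⇒isDeltaMatroid {m} {F} F⊇odd = (⁅ zero ⁆ , odd∈F ⁅ zero ⁆ (parity-⁅x⁆ {suc m} zero)) , exchange
  where
  odd∈F : ∀ X → parity X ≡ true → X ∈ℱ F
  odd∈F = containsAllOfParity⇒∈ℱ F⊇odd

  exchange : Exchange F
  exchange X Y _ Y∈ e e∈ with parity X in pX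
  ... | false = e , e∈ , odd∈F (X △ (⁅ e ⁆ ∪ ⁅ e ⁆)) (begin
      parity (X △ (⁅ e ⁆ ∪ ⁅ e ⁆))         ≡⟨ parity-△ X (⁅ e ⁆ ∪ ⁅ e ⁆) ⟩
      parity X xor parity (⁅ e ⁆ ∪ ⁅ e ⁆)  ≡⟨ cong₂ _xor_ pX (trans (cong parity (∪-idem ⁅ e ⁆)) (parity-⁅x⁆ e)) ⟩
      true                                  ∎)
    where open ≡-Reasoning
  ... | true with x∈p⇒p≡⁅x⁆⊎∃y≢x e∈
  ...   | inj₁ X△Y≡⁅e⁆ = e , e∈ , subst (_∈ℱ F) Y≡X△⁅e⁆ Y∈
    where
    open ≡-Reasoning
    Y≡X△⁅e⁆ : Y ≡ X △ (⁅ e ⁆ ∪ ⁅ e ⁆)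
    Y≡X△⁅e⁆ = begin
      Y                      ≡⟨ △-cancelˡ X Y ⟨
      X △ (X △ Y)            ≡⟨ cong (X △_) X△Y≡⁅e⁆ ⟩
      X △ ⁅ e ⁆              ≡⟨ cong (X △_) (∪-idem ⁅ e ⁆) ⟨
      X △ (⁅ e ⁆ ∪ ⁅ e ⁆)    ∎
  ...   | inj₂ (f , f∈ , f≢e) = f , f∈ , odd∈F (X △ (⁅ e ⁆ ∪ ⁅ f ⁆))
      (trans (parity-△ X (⁅ e ⁆ ∪ ⁅ f ⁆)) (cong₂ _xor_ pX (parity-⁅x⁆∪⁅y⁆ (f≢e ∘ sym))))

2^2^m≤d[1+m] : ∀ m → 2 ^ 2 ^ m ≤ d (suc m)
2^2^m≤d[1+m] m = begin
  2 ^ 2 ^ m                                                ≡⟨ count-containsAllOfParity m true ⟨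
  count (containsAllOfParity? true) (allFamilies (suc m))  ≤⟨ count-mono (containsAllOfParity? true) isDeltaMatroid?
                                                                containsAllOdd⇒isDeltaMatroid (allFamilies (suc m)) ⟩
  d (suc m)                                                ∎
  where open ≤-Reasoning

count-isDeltaMatroidOrEmpty-< : ∀ m →
  count isDeltaMatroidOrEmpty? (allFamilies (3 + m)) <
  count isDeltaMatroidOrEmpty? (allFamilies (2 + m)) * count isDeltaMatroidOrEmpty? (allFamilies (2 + m))
count-isDeltaMatroidOrEmpty-< m = begin-strict
  count isDeltaMatroidOrEmpty? (allFamilies (3 + m))
    <⟨ count-mono-< isDeltaMatroidOrEmpty? (isDeltaMatroidOrEmpty? ×? isDeltaMatroidOrEmpty?)
         isDeltaMatroidOrEmpty-minors (allFamilies-complete (farPair {m}))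
         farPair-minors ¬isDeltaMatroidOrEmpty-farPair ⟩
  count (isDeltaMatroidOrEmpty? ×? isDeltaMatroidOrEmpty?) (allFamilies (3 + m))
    ≡⟨ count-cartesianProduct isDeltaMatroidOrEmpty? isDeltaMatroidOrEmpty? L L ⟩
  count isDeltaMatroidOrEmpty? L * count isDeltaMatroidOrEmpty? L ∎
  where
  open ≤-Reasoning
  L = allFamilies (2 + m)

theorem10 : ((n : ℕ) → 1 ≤ n → 2 ^ (2 ^ (n ∸ 1)) < d n + 1)
    × ((n : ℕ) → 2 ≤ n → d (suc n) + 1 < (d n + 1) ^ 2)
theorem10 = lower , growth
  where
  open ≤-Reasoning

  lower : (n : ℕ) → 1 ≤ n → 2 ^ (2 ^ (n ∸ 1)) < d n + 1
  lower (suc m) _ = begin-strict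
    2 ^ 2 ^ m      ≤⟨ 2^2^m≤d[1+m] m ⟩
    d (suc m)      <⟨ m<m+n (d (suc m)) z<s ⟩
    d (suc m) + 1  ∎

  growth : (n : ℕ) → 2 ≤ n → d (suc n) + 1 < (d n + 1) ^ 2
  growth (suc zero)    (s≤s ())
  growth (suc (suc m)) _        = begin-strict
    d (3 + m) + 1                                        ≡⟨ count-isDeltaMatroidOrEmpty (3 + m) ⟨
    count isDeltaMatroidOrEmpty? (allFamilies (3 + m))  <⟨ count-isDeltaMatroidOrEmpty-< m ⟩
    count isDeltaMatroidOrEmpty? (allFamilies (2 + m)) * count isDeltaMatroidOrEmpty? (allFamilies (2 + m))
      ≡⟨ cong₂ _*_ (count-isDeltaMatroidOrEmpty (2 + m)) (count-isDeltaMatroidOrEmpty (2 + m)) ⟩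
    (d (2 + m) + 1) * (d (2 + m) + 1)                    ≡⟨ cong ((d (2 + m) + 1) *_) (*-identityʳ (d (2 + m) + 1)) ⟨
    (d (2 + m) + 1) ^ 2                                  ∎
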